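{- For every $n\geq 1$, every $n$-universal tree is a parity-preserving minor-universal tree for the class of rooted binary trees with $n$ leaves and no node of degree $1$.
   Context: Trees are finite and rooted; the degree of a node is its number of children; the depth of the root is $0$; binary means at most two children per node; $\mathsf{NCA}$ is the nearest common ancestor. Cutting: select nodes $a,b$ with $a$ a child of $b$, and remove the entire subtree rooted at $a$ and the edge between $a$ and $b$. Contraction: select an internal node $b$ with parent $a$ and exactly one child $c$; remove $b$; if $c$ is internal, the children of $c$ are made children of $a$ and $c$ is removed; if $c$ is a leaf, it becomes a child of $a$. $T$ implements $T'$ if $T'$ can be obtained from $T$ by a sequence of cuttings and contractions. $T$ is $n$-universal if it implements every rooted tree with at most $n$ leaves and no node of degree $1$. A rooted tree $T$ is a parity-preserving minor-universal tree for a class $\mathcal{T}$ if for every $T'\in\mathcal{T}$ there is an injective map $f$ from the nodes of $T'$ to the nodes of $T$ with $f(\mathsf{NCA}(u,v))=\mathsf{NCA}(f(u),f(v))$ for all $u,v\in T'$ and such that the depth of $f(u)$ in $T$ and the depth of $u$ in $T'$ have the same parity for every $u\in T'$. -}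

module Defs where

open import Data.Nat using (ℕ; zero; suc; _+_; _≤_; _%_; _≟_)
open import Data.List using (List; []; _∷_; _++_; length)
open import Data.Maybe using (Maybe; just; nothing)
open import Data.Product using (_×_; Σ; ∃; _,_)
open import Relation.Binary.PropositionalEquality using (_≡_; _≢_)
open import Relation.Nullary using (¬_; yes; no)
open import Data.Unit using (⊤)

-- Children are stored in a list (a plane tree);
-- since the paper's trees are unordered, reordering children is allowed
-- as a free step in "implements" (see Step.swap), and the minor
-- embedding notion does not refer to the order at all.

data Tree : Set where
  node : List Tree → Tree

leaf : Tree
leaf = node []

mutual
  leaves : Tree → ℕ
  leaves (node []) = 1
  leaves (node (t ∷ ts)) = leavesL (t ∷ ts)

  leavesL : List Tree → ℕ
  leavesL [] = 0
  leavesL (t ∷ ts) = leaves t + leavesL ts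

mutual
  NoUnary : Tree → Set
  NoUnary (node ts) = (length ts ≢ 1) × NoUnaryL ts

  NoUnaryL : List Tree → Set
  NoUnaryL [] = ⊤
  NoUnaryL (t ∷ ts) = NoUnary t × NoUnaryL ts

mutual
  Binary : Tree → Set
  Binary (node ts) = (length ts ≤ 2) × BinaryL ts

  BinaryL : List Tree → Set
  BinaryL [] = ⊤
  BinaryL (t ∷ ts) = Binary t × BinaryL ts

data Step : Tree → Tree → Set where
  cut      : ∀ xs t ys → Step (node (xs ++ t ∷ ys)) (node (xs ++ ys))
  -- contraction of a (non-root) node b = node (c ∷ []) with internal
  -- only child c = node cs: both b and c are removed and the children
  -- of c become children of the parent a of b
  contract-internal : ∀ xs c cs ys → Step
    (node (xs ++ node (node (c ∷ cs) ∷ []) ∷ ys))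
    (node (xs ++ (c ∷ cs) ++ ys))
  contract-leaf : ∀ xs ys → Step
    (node (xs ++ node (leaf ∷ []) ∷ ys))
    (node (xs ++ leaf ∷ ys))
  swap     : ∀ xs s t ys → Step (node (xs ++ s ∷ t ∷ ys)) (node (xs ++ t ∷ s ∷ ys))
  inside   : ∀ xs {t t'} ys → Step t t' → Step (node (xs ++ t ∷ ys)) (node (xs ++ t' ∷ ys))

data Steps : Tree → Tree → Set where
  done : ∀ {t} → Steps t t
  _∷ₛ_ : ∀ {t u v} → Step t u → Steps u v → Steps t v

Implements : Tree → Tree → Set
Implements T T' = Steps T T'

Universal : ℕ → Tree → Set
Universal n T = ∀ T' → leaves T' ≤ n → NoUnary T' → Implements T T'

-- Nodes of a tree are addressed by paths from the root (list of child
-- indices, 0-based).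

Addr : Set
Addr = List ℕ

at : List Tree → ℕ → Maybe Tree
at [] _ = nothing
at (t ∷ ts) zero = just t
at (t ∷ ts) (suc i) = at ts i

data Valid : Tree → Addr → Set where
  root  : ∀ {t} → Valid t []
  child : ∀ {ts t i p} → at ts i ≡ just t → Valid t p → Valid (node ts) (i ∷ p)

depth : Addr → ℕ
depth = length

nca : Addr → Addr → Addr
nca (i ∷ p) (j ∷ q) with i ≟ j
... | yes _ = i ∷ nca p q
... | no _ = []
nca _ _ = []

record ParityEmbedding (T' T : Tree) : Set where
  field
    f        : Addr → Addr
    valid    : ∀ {u} → Valid T' u → Valid T (f u)
    injective : ∀ {u v} → Valid T' u → Valid T' v → f u ≡ f v → u ≡ v
    nca-pres : ∀ {u v} → Valid T' u → Valid T' v → f (nca u v) ≡ nca (f u) (f v)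
    parity   : ∀ {u} → Valid T' u → depth (f u) % 2 ≡ depth u % 2

ParityMinorUniversal : Tree → (Tree → Set) → Set
ParityMinorUniversal T C = ∀ T' → C T' → ParityEmbedding T' T

BinaryClass : ℕ → Tree → Set
BinaryClass n T' = Binary T' × NoUnary T' × (leaves T' ≡ n)

-- We introduce an inductive relation  Embeds s t b : "s embeds
-- into t with depth-parity shift b", built from three rules: descend into a
-- child (flipping the shift), map a leaf onto the root (shift 0), and map a
-- binary root onto the root with its two subtrees embedded (shift 0) into two
-- distinct children.  The proof then has three parts.
--   1. Reflexivity: a binary tree without unary nodes embeds into itself.
--   2. Reflection: if u arises from t by one cutting, contraction or swap,
--      every embedding into u yields one into t.  Each step only changes one
--      list of children, so it suffices to show that the new list "simulates"
--      the old one (Simulates); the only subtle case is an internal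
--      contraction, which removes two levels at once and so keeps parities.
--   3. Extraction: Embeds s t b yields an injective, NCA-preserving map on
--      addresses whose depth parity is shifted by b.
-- Given T' in the class, universality gives Steps T T'; then 1, 2 and 3.

module Submission where

open import Defs
open import Data.Nat using (ℕ; _≤_; zero; suc; _%_; _≟_; s≤s)
open import Data.Nat.Properties using (≤-reflexive; suc-injective)
open import Data.Bool using (Bool; true; false; not; _xor_; if_then_else_)
open import Data.Bool.Properties using (not-involutive; not-distribˡ-xor)
open import Data.List using (List; []; _∷_; _++_)
open import Data.List.Relation.Unary.Any using (Any; here; there)
open import Data.List.Relation.Unary.Any.Properties using (++⁻)
open import Data.Maybe using (just)
open import Data.Product using (Σ; _×_; _,_; proj₁; proj₂)
open import Data.Sum using (_⊎_; inj₁; inj₂)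
open import Data.Empty using (⊥-elim)
open import Relation.Nullary using (yes; no)
open import Relation.Binary.PropositionalEquality
  using (_≡_; _≢_; refl; sym; trans; cong)

data TwoApart {A : Set} (P Q : A → Set) : List A → Set where
  p-then-q : ∀ {x xs} → P x → Any Q xs → TwoApart P Q (x ∷ xs)
  q-then-p : ∀ {x xs} → Q x → Any P xs → TwoApart P Q (x ∷ xs)
  skip     : ∀ {x xs} → TwoApart P Q xs → TwoApart P Q (x ∷ xs)

-- Embeds s t b: s is a minor of t such that depths of images have the
-- parity of the original depths shifted by b (true = odd shift).
data Embeds : Tree → Tree → Bool → Set

Hosts : Tree → Bool → Tree → Set
Hosts s b x = Embeds s x b

data Embeds where
  descend : ∀ {s ts b} → Any (Hosts s (not b)) ts → Embeds s (node ts) b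
  leaf↪   : ∀ {ts} → Embeds leaf (node ts) false
  fork    : ∀ {s₁ s₂ ts} → TwoApart (Hosts s₁ false) (Hosts s₂ false) ts →
            Embeds (node (s₁ ∷ s₂ ∷ [])) (node ts) false

HostPair : Tree → Tree → List Tree → Set
HostPair s₁ s₂ = TwoApart (Hosts s₁ false) (Hosts s₂ false)

embeds-refl : ∀ s → Binary s → NoUnary s → Embeds s s false
embeds-refl (node []) _ _ = leaf↪
embeds-refl (node (_ ∷ [])) _ (not-unary , _) = ⊥-elim (not-unary refl)
embeds-refl (node (a ∷ b ∷ [])) (_ , bin-a , bin-b , _) (_ , nu-a , nu-b , _) =
  fork (p-then-q (embeds-refl a bin-a nu-a) (here (embeds-refl b bin-b nu-b)))
embeds-refl (node (_ ∷ _ ∷ _ ∷ _)) (s≤s (s≤s ()) , _) _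

twoApart-++⁻ : ∀ {A : Set} {P Q : A → Set} xs {ys} → TwoApart P Q (xs ++ ys) →
  TwoApart P Q xs ⊎ TwoApart P Q ys ⊎ (Any P xs × Any Q ys) ⊎ (Any Q xs × Any P ys)
twoApart-++⁻ [] two = inj₂ (inj₁ two)
twoApart-++⁻ (x ∷ xs) (p-then-q p q) with ++⁻ xs q
... | inj₁ q-xs = inj₁ (p-then-q p q-xs)
... | inj₂ q-ys = inj₂ (inj₂ (inj₁ (here p , q-ys)))
twoApart-++⁻ (x ∷ xs) (q-then-p q p) with ++⁻ xs p
... | inj₁ p-xs = inj₁ (q-then-p q p-xs)
... | inj₂ p-ys = inj₂ (inj₂ (inj₂ (here q , p-ys)))
twoApart-++⁻ (x ∷ xs) (skip two) with twoApart-++⁻ xs two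
... | inj₁ t = inj₁ (skip t)
... | inj₂ (inj₁ t) = inj₂ (inj₁ t)
... | inj₂ (inj₂ (inj₁ (p , q))) = inj₂ (inj₂ (inj₁ (there p , q)))
... | inj₂ (inj₂ (inj₂ (q , p))) = inj₂ (inj₂ (inj₂ (there q , p)))

HostsFork : Tree → Tree → List Tree → Set
HostsFork s₁ s₂ ts = HostPair s₁ s₂ ts ⊎ Any (Hosts (node (s₁ ∷ s₂ ∷ [])) true) ts

-- Simulates new old: every way the children `new` can host an embedding
-- (one child, or two distinct children for a fork) is also available in
-- `old`; a fork may instead be hosted one level deeper, inside a single child.
record Simulates (new old : List Tree) : Set where
  field
    one : ∀ {s b} → Any (Hosts s b) new → Any (Hosts s b) old
    two : ∀ {s₁ s₂} → HostPair s₁ s₂ new → HostsFork s₁ s₂ old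

simulates⇒embeds : ∀ {new old} → Simulates new old →
  ∀ {s b} → Embeds s (node new) b → Embeds s (node old) b
simulates⇒embeds sim (descend any) = descend (Simulates.one sim any)
simulates⇒embeds sim leaf↪ = leaf↪
simulates⇒embeds sim (fork two) with Simulates.two sim two
... | inj₁ two' = fork two'
... | inj₂ deeper = descend deeper

simulates-prefix : ∀ xs {new old} → Simulates new old →
  Simulates (xs ++ new) (xs ++ old)
simulates-prefix xs {new} {old} sim = record { one = one xs ; two = two xs }
  where
  open Simulates sim renaming (one to one₀; two to two₀)
  one : ∀ ys {s b} → Any (Hosts s b) (ys ++ new) → Any (Hosts s b) (ys ++ old)
  one [] a = one₀ a
  one (y ∷ ys) (here h) = here h
  one (y ∷ ys) (there a) = there (one ys a)
  two : ∀ ys {s₁ s₂} → HostPair s₁ s₂ (ys ++ new) → HostsFork s₁ s₂ (ys ++ old)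
  two [] t = two₀ t
  two (y ∷ ys) (p-then-q p q) = inj₁ (p-then-q p (one ys q))
  two (y ∷ ys) (q-then-p q p) = inj₁ (q-then-p q (one ys p))
  two (y ∷ ys) (skip t) with two ys t
  ... | inj₁ t' = inj₁ (skip t')
  ... | inj₂ a = inj₂ (there a)

simulates-head : ∀ {t t'} ys → (∀ {s b} → Embeds s t' b → Embeds s t b) →
  Simulates (t' ∷ ys) (t ∷ ys)
simulates-head {t} {t'} ys back = record { one = one ; two = two }
  where
  one : ∀ {s b} → Any (Hosts s b) (t' ∷ ys) → Any (Hosts s b) (t ∷ ys)
  one (here e) = here (back e)
  one (there a) = there a
  two : ∀ {s₁ s₂} → HostPair s₁ s₂ (t' ∷ ys) → HostsFork s₁ s₂ (t ∷ ys)
  two (p-then-q p q) = inj₁ (p-then-q (back p) q)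
  two (q-then-p q p) = inj₁ (q-then-p (back q) p)
  two (skip t) = inj₁ (skip t)

simulates-cut : ∀ t ys → Simulates ys (t ∷ ys)
simulates-cut t ys = record { one = there ; two = λ t → inj₁ (skip t) }

simulates-swap : ∀ s t ys → Simulates (t ∷ s ∷ ys) (s ∷ t ∷ ys)
simulates-swap s t ys = record { one = one ; two = two }
  where
  one : ∀ {P : Tree → Set} → Any P (t ∷ s ∷ ys) → Any P (s ∷ t ∷ ys)
  one (here p) = there (here p)
  one (there (here p)) = here p
  one (there (there p)) = there (there p)
  two : ∀ {s₁ s₂} → HostPair s₁ s₂ (t ∷ s ∷ ys) → HostsFork s₁ s₂ (s ∷ t ∷ ys)
  two (p-then-q p (here q)) = inj₁ (q-then-p q (here p))
  two (p-then-q p (there q)) = inj₁ (skip (p-then-q p q))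
  two (q-then-p q (here p)) = inj₁ (p-then-q p (here q))
  two (q-then-p q (there p)) = inj₁ (skip (q-then-p q p))
  two (skip (p-then-q p q)) = inj₁ (p-then-q p (there q))
  two (skip (q-then-p q p)) = inj₁ (q-then-p q (there p))
  two (skip (skip t)) = inj₁ (skip (skip t))

-- Going through a single-child node b into the children of its child adds two
-- to every depth, so the parity shift is unchanged (the match on b only makes
-- `not (not b)` reduce).
embeds-through-two : ∀ {s cs} b → Any (Hosts s b) cs →
  Embeds s (node (node cs ∷ [])) b
embeds-through-two true a = descend (here (descend a))
embeds-through-two false a = descend (here (descend a))

-- Contraction of an internal node: the children of c move up two levels.
simulates-contract-internal : ∀ c cs ys →
  Simulates ((c ∷ cs) ++ ys) (node (node (c ∷ cs) ∷ []) ∷ ys)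
simulates-contract-internal c cs ys = record { one = one ; two = two }
  where
  one : ∀ {s b} → Any (Hosts s b) ((c ∷ cs) ++ ys) →
        Any (Hosts s b) (node (node (c ∷ cs) ∷ []) ∷ ys)
  one {b = b} a with ++⁻ (c ∷ cs) a
  ... | inj₁ a-cs = here (embeds-through-two b a-cs)
  ... | inj₂ a-ys = there a-ys
  -- a fork hosted among the children of c is now hosted inside b itself
  two : ∀ {s₁ s₂} → HostPair s₁ s₂ ((c ∷ cs) ++ ys) →
        HostsFork s₁ s₂ (node (node (c ∷ cs) ∷ []) ∷ ys)
  two t with twoApart-++⁻ (c ∷ cs) t
  ... | inj₁ t-cs = inj₂ (here (descend (here (fork t-cs))))
  ... | inj₂ (inj₁ t-ys) = inj₁ (skip t-ys)
  ... | inj₂ (inj₂ (inj₁ (p , q))) = inj₁ (p-then-q (embeds-through-two false p) q)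
  ... | inj₂ (inj₂ (inj₂ (q , p))) = inj₁ (q-then-p (embeds-through-two false q) p)

-- Contraction above a leaf: the leaf may as well be mapped onto its parent.
leaf-under-unary : ∀ {s b} → Embeds s leaf b → Embeds s (node (leaf ∷ [])) b
leaf-under-unary (descend ())
leaf-under-unary leaf↪ = leaf↪
leaf-under-unary (fork ())

step-reflects : ∀ {t u} → Step t u → ∀ {s b} → Embeds s u b → Embeds s t b
step-reflects (cut xs t ys) =
  simulates⇒embeds (simulates-prefix xs (simulates-cut t ys))
step-reflects (contract-internal xs c cs ys) =
  simulates⇒embeds (simulates-prefix xs (simulates-contract-internal c cs ys))
step-reflects (contract-leaf xs ys) =
  simulates⇒embeds (simulates-prefix xs (simulates-head ys leaf-under-unary))
step-reflects (swap xs s t ys) =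
  simulates⇒embeds (simulates-prefix xs (simulates-swap s t ys))
step-reflects (inside xs ys st) =
  simulates⇒embeds (simulates-prefix xs (simulates-head ys (step-reflects st)))

steps-reflect : ∀ {t u} → Steps t u → ∀ {s b} → Embeds s u b → Embeds s t b
steps-reflect done e = e
steps-reflect (st ∷ₛ sts) e = step-reflects st (steps-reflect sts e)

-- Depth parities are tracked as booleans and converted to `% 2` at the end.
even : ℕ → Bool
even zero = true
even (suc n) = not (even n)

record ShiftedEmbedding (s t : Tree) (b : Bool) : Set where
  field
    f         : Addr → Addr
    valid     : ∀ {u} → Valid s u → Valid t (f u)
    injective : ∀ {u v} → Valid s u → Valid s v → f u ≡ f v → u ≡ v
    nca-pres  : ∀ {u v} → Valid s u → Valid s v → f (nca u v) ≡ nca (f u) (f v)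
    parity    : ∀ {u} → Valid s u → even (depth (f u)) ≡ b xor even (depth u)

nca-same : ∀ i p q → nca (i ∷ p) (i ∷ q) ≡ i ∷ nca p q
nca-same i p q with i ≟ i
... | yes _ = refl
... | no i≢i = ⊥-elim (i≢i refl)

nca-diff : ∀ {i j} p q → i ≢ j → nca (i ∷ p) (j ∷ q) ≡ []
nca-diff {i} {j} p q i≢j with i ≟ j
... | yes i≡j = ⊥-elim (i≢j i≡j)
... | no _ = refl

∷-injective : ∀ {i j : ℕ} {p q} → i ∷ p ≡ j ∷ q → i ≡ j × p ≡ q
∷-injective refl = refl , refl

valid-leaf : ∀ {u} → Valid leaf u → u ≡ []
valid-leaf root = refl
valid-leaf (child () _)

leaf-embedding : ∀ {ts} → ShiftedEmbedding leaf (node ts) false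
leaf-embedding = record
  { f = λ _ → []
  ; valid = λ _ → root
  ; injective = λ vu vv _ → trans (valid-leaf vu) (sym (valid-leaf vv))
  ; nca-pres = λ _ _ → refl
  ; parity = λ vu → cong (λ u → even (depth u)) (sym (valid-leaf vu))
  }

descend-embedding : ∀ {s ts x b} i → at ts i ≡ just x →
  ShiftedEmbedding s x (not b) → ShiftedEmbedding s (node ts) b
descend-embedding {b = b} i at-i m = record
  { f = λ u → i ∷ f u
  ; valid = λ vu → child at-i (valid vu)
  ; injective = λ vu vv e → injective vu vv (proj₂ (∷-injective e))
  ; nca-pres = λ {u} {v} vu vv →
      trans (cong (i ∷_) (nca-pres vu vv)) (sym (nca-same i (f u) (f v)))
  ; parity = λ {u} vu → trans (cong not (parity vu)) (not-not-xor (even (depth u)))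
  }
  where
  open ShiftedEmbedding m
  not-not-xor : ∀ x → not (not b xor x) ≡ b xor x
  not-not-xor x = trans (not-distribˡ-xor (not b) x) (cong (_xor x) (not-involutive b))

-- A binary root goes to the root, its two subtrees into distinct children
-- i ≠ j; distinctness makes the NCA of the two sides the root again.
module ForkEmbedding {s₁ s₂ x₁ x₂ : Tree} {ts : List Tree} (i j : ℕ) (i≢j : i ≢ j)
  (at-i : at ts i ≡ just x₁) (at-j : at ts j ≡ just x₂)
  (m₁ : ShiftedEmbedding s₁ x₁ false) (m₂ : ShiftedEmbedding s₂ x₂ false) where
  private
    module M₁ = ShiftedEmbedding m₁
    module M₂ = ShiftedEmbedding m₂
    S = node (s₁ ∷ s₂ ∷ [])

    g : Addr → Addr
    g [] = []
    g (zero ∷ p) = i ∷ M₁.f p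
    g (suc zero ∷ p) = j ∷ M₂.f p
    g (suc (suc _) ∷ p) = []

    g-valid : ∀ {u} → Valid S u → Valid (node ts) (g u)
    g-valid root = root
    g-valid (child {i = zero} refl vp) = child at-i (M₁.valid vp)
    g-valid (child {i = suc zero} refl vp) = child at-j (M₂.valid vp)
    g-valid (child {i = suc (suc _)} () vp)

    g-injective : ∀ {u v} → Valid S u → Valid S v → g u ≡ g v → u ≡ v
    g-injective root root e = refl
    g-injective root (child {i = zero} refl vp) ()
    g-injective root (child {i = suc zero} refl vp) ()
    g-injective (child {i = zero} refl vp) root ()
    g-injective (child {i = suc zero} refl vp) root ()
    g-injective (child {i = zero} refl vp) (child {i = zero} refl vq) e =
      cong (zero ∷_) (M₁.injective vp vq (proj₂ (∷-injective e)))
    g-injective (child {i = zero} refl vp) (child {i = suc zero} refl vq) e =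
      ⊥-elim (i≢j (proj₁ (∷-injective e)))
    g-injective (child {i = suc zero} refl vp) (child {i = zero} refl vq) e =
      ⊥-elim (i≢j (sym (proj₁ (∷-injective e))))
    g-injective (child {i = suc zero} refl vp) (child {i = suc zero} refl vq) e =
      cong (suc zero ∷_) (M₂.injective vp vq (proj₂ (∷-injective e)))

    g-nca : ∀ {u v} → Valid S u → Valid S v → g (nca u v) ≡ nca (g u) (g v)
    g-nca root _ = refl
    g-nca (child {i = zero} refl vp) root = refl
    g-nca (child {i = suc zero} refl vp) root = refl
    g-nca (child {i = zero} {p = p} refl vp) (child {i = zero} {p = q} refl vq) =
      trans (cong g (nca-same zero p q))
        (trans (cong (i ∷_) (M₁.nca-pres vp vq)) (sym (nca-same i (M₁.f p) (M₁.f q))))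
    g-nca (child {i = suc zero} {p = p} refl vp) (child {i = suc zero} {p = q} refl vq) =
      trans (cong g (nca-same (suc zero) p q))
        (trans (cong (j ∷_) (M₂.nca-pres vp vq)) (sym (nca-same j (M₂.f p) (M₂.f q))))
    g-nca (child {i = zero} {p = p} refl vp) (child {i = suc zero} {p = q} refl vq) =
      trans (cong g (nca-diff {zero} {suc zero} p q (λ ())))
        (sym (nca-diff (M₁.f p) (M₂.f q) i≢j))
    g-nca (child {i = suc zero} {p = p} refl vp) (child {i = zero} {p = q} refl vq) =
      trans (cong g (nca-diff {suc zero} {zero} p q (λ ())))
        (sym (nca-diff (M₂.f p) (M₁.f q) (λ j≡i → i≢j (sym j≡i))))

    g-parity : ∀ {u} → Valid S u → even (depth (g u)) ≡ false xor even (depth u)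
    g-parity root = refl
    g-parity (child {i = zero} refl vp) = cong not (M₁.parity vp)
    g-parity (child {i = suc zero} refl vp) = cong not (M₂.parity vp)

  fork-embedding : ShiftedEmbedding S (node ts) false
  fork-embedding = record
    { f = g ; valid = g-valid ; injective = g-injective ; nca-pres = g-nca ; parity = g-parity }

open ForkEmbedding using (fork-embedding)

mutual
  shifted-embedding : ∀ {s t b} → Embeds s t b → ShiftedEmbedding s t b
  shifted-embedding (descend a) with hosting-child a
  ... | i , _ , at-i , m = descend-embedding i at-i m
  shifted-embedding leaf↪ = leaf-embedding
  shifted-embedding (fork t) with hosting-children t
  ... | i , j , _ , _ , i≢j , at-i , at-j , m₁ , m₂ = fork-embedding i j i≢j at-i at-j m₁ m₂

  hosting-child : ∀ {s b ts} → Any (Hosts s b) ts →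
    Σ ℕ λ i → Σ Tree λ x → at ts i ≡ just x × ShiftedEmbedding s x b
  hosting-child (here e) = zero , _ , refl , shifted-embedding e
  hosting-child (there a) with hosting-child a
  ... | i , x , at-i , m = suc i , x , at-i , m

  hosting-children : ∀ {s₁ s₂ ts} → HostPair s₁ s₂ ts →
    Σ ℕ λ i → Σ ℕ λ j → Σ Tree λ x₁ → Σ Tree λ x₂ →
      i ≢ j × at ts i ≡ just x₁ × at ts j ≡ just x₂ ×
      ShiftedEmbedding s₁ x₁ false × ShiftedEmbedding s₂ x₂ false
  hosting-children (p-then-q p q) with hosting-child q
  ... | j , x₂ , at-j , m₂ = zero , suc j , _ , x₂ , (λ ()) , refl , at-j , shifted-embedding p , m₂
  hosting-children (q-then-p q p) with hosting-child p
  ... | i , x₁ , at-i , m₁ = suc i , zero , x₁ , _ , (λ ()) , at-i , refl , m₁ , shifted-embedding q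
  hosting-children (skip t) with hosting-children t
  ... | i , j , x₁ , x₂ , i≢j , at-i , at-j , m₁ , m₂ =
    suc i , suc j , x₁ , x₂ , (λ e → i≢j (suc-injective e)) , at-i , at-j , m₁ , m₂

mod2-even : ∀ m → m % 2 ≡ (if even m then 0 else 1)
mod2-even zero = refl
mod2-even (suc zero) = refl
mod2-even (suc (suc k)) rewrite not-involutive (even k) = mod2-even k

same-even⇒same-mod2 : ∀ m n → even m ≡ even n → m % 2 ≡ n % 2
same-even⇒same-mod2 m n e =
  trans (mod2-even m) (trans (cong (λ b → if b then 0 else 1) e) (sym (mod2-even n)))

unshifted⇒parity-embedding : ∀ {s t} → ShiftedEmbedding s t false → ParityEmbedding s t
unshifted⇒parity-embedding m = record
  { f = f ; valid = valid ; injective = injective ; nca-pres = nca-pres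
  ; parity = λ {u} vu → same-even⇒same-mod2 (depth (f u)) (depth u) (parity vu) }
  where open ShiftedEmbedding m

-- The theorem: T' is implemented by T, so its self-embedding is reflected
-- into T.
lemma14 : ∀ (n : ℕ) → 1 ≤ n → (T : Tree) → Universal n T →
    ParityMinorUniversal T (BinaryClass n)
lemma14 n _ T universal T' (binary , no-unary , leaves≡n) =
  unshifted⇒parity-embedding (shifted-embedding T'-embeds-into-T)
  where
  T-implements-T' : Implements T T'
  T-implements-T' = universal T' (≤-reflexive leaves≡n) no-unary

  T'-embeds-into-T : Embeds T' T false
  T'-embeds-into-T = steps-reflect T-implements-T' (embeds-refl T' binary no-unary)
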